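{- Let $T_1,T_2$ be decorated trees and $i$ an integer with $1\le i\le\operatorname{fl}(T_1)$. Then $T=\oplus_{\mathcal T}(T_1,i,T_2)$ is a decorated tree, with $\operatorname{hd}_{\mathcal T}(T)=T_1$, $\operatorname{tl}_{\mathcal T}(T)=T_2$ and $\operatorname{fl}(T)=i+\operatorname{fl}(T_2)$. Furthermore, for every decorated tree $T'$ whose root has at least two children with the leftmost child an internal node, if $\operatorname{hd}_{\mathcal T}(T')=T_1$ and $\operatorname{tl}_{\mathcal T}(T')=T_2$, then there is a unique integer $j$ with $1\le j\le\operatorname{fl}(T_1)$ such that $T'=\oplus_{\mathcal T}(T_1,j,T_2)$.
   Context: All trees are rooted plane trees (children of each node linearly ordered from left to right). The depth of the root is $0$; the traversal order is the prefix (preorder, left-to-right depth-first) order. A decorated tree is a rooted plane tree with at least one edge in which each leaf carries an integer label $\ge -1$, such that: (1) the label of each leaf is strictly less than the depth of its parent; (2) every internal node of depth $p>0$ has at least one descendant leaf with label at most $p-2$; (3) for every internal node $t$ of depth $p$, every subtree $T''$ rooted at a child of $t$, and every leaf $\ell$ of $T''$ with label equal to $p$, all leaves of $T''$ preceding $\ell$ in traversal order have labels at least $p$. A leaf labeled $-1$ is free; $\operatorname{fl}(T)$ is the number of free leaves. For a decorated tree $T$ and $1\le i\le\operatorname{fl}(T)$, $\Delta_{\mathcal T}(T,i)$ is obtained by attaching the root of $T$ as the only child of a new root and adding $1$ to the label of every leaf except the last $i$ free leaves in traversal order. For a labeled tree whose root has exactly one child, $\Pi_{\mathcal T}$ deletes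 the root (its child becomes the new root) and subtracts $1$ from the label of every non-free leaf. $\oplus_{\mathcal T}(T_1,i,T_2)$ is the tree obtained by identifying the roots of $\Delta_{\mathcal T}(T_1,i)$ and $T_2$, the child coming from $\Delta_{\mathcal T}(T_1,i)$ being placed as the leftmost child of the common root. For a tree $T$ whose root has at least two children, let $T_{hd}$ be the tree formed by the root, its leftmost child and the subtree of that child, and $T_{tl}$ the tree formed by the root together with all its other children and their subtrees; then $\operatorname{hd}_{\mathcal T}(T)=\Pi_{\mathcal T}(T_{hd})$ and $\operatorname{tl}_{\mathcal T}(T)=T_{tl}$. -}

module Defs where

open import Data.Nat as ℕ using (ℕ; zero; suc; _∸_)
open import Data.Integer as ℤ using (ℤ; +_; -[1+_])
open import Data.List using (List; []; _∷_; _++_; length; filter)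
open import Data.List.Relation.Unary.All using (All)
open import Data.List.Relation.Unary.Any using (Any)
open import Data.Product using (_×_; _,_; proj₂; ∃)
open import Data.Unit using (⊤)
open import Data.Empty using (⊥)
open import Relation.Binary.PropositionalEquality using (_≡_; _≢_)
open import Relation.Nullary using (yes; no)

-- A 'node ts' is an internal node with ordered children ts (left to right);
-- decorated trees never contain 'node []' (enforced in Ok below).
data Tree : Set where
  leaf : ℤ → Tree
  node : List Tree → Tree

free : ℤ
free = -[1+ 0 ]

leaves  : Tree → List ℤ
leavesL : List Tree → List ℤ
leaves (leaf z) = z ∷ []
leaves (node ts) = leavesL ts
leavesL [] = []
leavesL (t ∷ ts) = leaves t ++ leavesL ts

fl : Tree → ℕ
fl T = length (filter (ℤ._≟ free) (leaves T))

children : Tree → List Tree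
children (leaf _) = []
children (node ts) = ts

Internal : Tree → Set
Internal (leaf _) = ⊥
Internal (node _) = ⊤

-- Ok d t : the subtree t, whose root sits at depth d, satisfies the
-- decoration conditions (1)-(3) at all of its nodes.
data Ok : ℕ → Tree → Set where
  okLeaf : ∀ {p} {z : ℤ} → free ℤ.≤ z → z ℤ.< + p → Ok (suc p) (leaf z)
    -- a leaf at depth p+1 has parent of depth p: label ≥ -1 and (1) label < p
  okNode : ∀ {d} {ts : List Tree} →
    ts ≢ [] →
    All (Ok (suc d)) ts →
    (0 ℕ.< d → Any (λ x → x ℤ.≤ (+ d) ℤ.- (+ 2)) (leavesL ts)) →   -- (2)
    All (λ c → ∀ xs ys → leaves c ≡ xs ++ (+ d) ∷ ys → All ((+ d) ℤ.≤_) xs) ts → -- (3)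
    Ok d (node ts)

Decorated : Tree → Set
Decorated T = Internal T × Ok 0 T

-- add 1 to the labels of all non-free leaves and of the first n free leaves
-- (in traversal order); returns the number of free leaves still to be shifted.
shiftT : ℕ → Tree → ℕ × Tree
shiftL : ℕ → List Tree → ℕ × List Tree
shiftT n (leaf z) with z ℤ.≟ free
shiftT zero    (leaf z) | yes _ = zero , leaf z
shiftT (suc n) (leaf z) | yes _ = n , leaf (z ℤ.+ + 1)
shiftT n       (leaf z) | no  _ = n , leaf (z ℤ.+ + 1)
shiftT n (node ts) with shiftL n ts
... | m , ts' = m , node ts'
shiftL n [] = n , []
shiftL n (t ∷ ts) with shiftT n t
... | m , t' with shiftL m ts
... | k , ts' = k , t' ∷ ts'

-- Δ_T(T,i): new root above T; +1 on every leaf except the last i free leaves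
Δ : Tree → ℕ → Tree
Δ T i = node (proj₂ (shiftT (fl T ∸ i) T) ∷ [])

decr : Tree → Tree
decrL : List Tree → List Tree
decr (leaf z) with z ℤ.≟ free
... | yes _ = leaf z
... | no  _ = leaf (z ℤ.- + 1)
decr (node ts) = node (decrL ts)
decrL [] = []
decrL (t ∷ ts) = decr t ∷ decrL ts

-- Π_T : only meaningful when the root has exactly one child (identity otherwise)
Π : Tree → Tree
Π (node (c ∷ [])) = decr c
Π T = T

-- identify the roots of S (a tree whose root has one child) and T2,
-- the child of S becoming the leftmost child (junk otherwise)
graft : Tree → Tree → Tree
graft (node (c ∷ [])) T2 = node (c ∷ children T2)
graft S T2 = S

⊕ : Tree → ℕ → Tree → Tree
⊕ T₁ i T₂ = graft (Δ T₁ i) T₂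

-- hd_T and tl_T : only meaningful when the root has ≥ 2 children
hd : Tree → Tree
hd (node (c ∷ cs)) = Π (node (c ∷ []))
hd T = T

tl : Tree → Tree
tl (node (c ∷ cs)) = node cs
tl T = T

LeftInternal2 : Tree → Set
LeftInternal2 T = ∃ λ c → ∃ λ c' → ∃ λ cs → (T ≡ node (c ∷ c' ∷ cs)) × Internal c

-- Δ adds 1 to every label except those of the last i free leaves and Π subtracts it again,
-- so hd ∘ ⊕ is the identity. The shifted copy of T₁ is decorated one level deeper since
-- its labels grow with the depth; condition (2) at depth 1 is witnessed by the
-- i kept free leaves, and condition (3) at the new root holds because the new labels 0
-- are the shifted free leaves, which all precede the kept ones. Conversely, condition (3)
-- at the root of T′ says that the labels 0 of its leftmost child c precede its free
-- leaves, so c is the shift of decr c keeping exactly fl c free leaves; and j = fl c is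
-- forced, since the leftmost child of ⊕ T₁ j T₂ has exactly j free leaves.

module Submission where

open import Defs
open import Data.Nat using (ℕ; _≤_; _+_)
open import Data.Product using (_×_; ∃!)
open import Relation.Binary.PropositionalEquality using (_≡_)

open import Data.Nat using (zero; suc; _∸_; _<_; z≤n; s≤s)
import Data.Nat.Properties as ℕₚ
open import Data.Integer as ℤ using (ℤ; +_; -[1+_])
import Data.Integer.Properties as ℤₚ
open import Data.List using (List; []; _∷_; _++_; length; filter)
import Data.List.Properties as Listₚ
open import Data.List.Membership.Propositional using (_∈_; _∉_)
open import Data.List.Membership.Propositional.Properties using (∈-++⁺ˡ; ∈-++⁺ʳ; ∈-∃++)
open import Data.List.Relation.Unary.All as All using (All; []; _∷_)
import Data.List.Relation.Unary.All.Properties as Allₚ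
open import Data.List.Relation.Unary.Any as Any using (Any; here; there)
open import Data.Product using (∃; _,_; proj₁; proj₂)
open import Data.Unit using (tt)
open import Data.Empty using (⊥-elim)
open import Function using (_∘_)
open import Relation.Nullary using (yes; no)
open import Relation.Binary.PropositionalEquality using (_≢_; refl; sym; trans; cong; cong₂; subst; module ≡-Reasoning)

freeCount : List ℤ → ℕ
freeCount = length ∘ filter (ℤ._≟ free)

freeCount-++ : ∀ xs ys → freeCount (xs ++ ys) ≡ freeCount xs + freeCount ys
freeCount-++ xs ys =
  trans (cong length (Listₚ.filter-++ (ℤ._≟ free) xs ys)) (Listₚ.length-++ (filter (ℤ._≟ free) xs))

free∈⇒freeCount-pos : ∀ {xs} → free ∈ xs → 1 ≤ freeCount xs
free∈⇒freeCount-pos = Listₚ.filter-some (ℤ._≟ free) ∘ Any.map sym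

freeCount-pos⇒free∈ : ∀ xs → 1 ≤ freeCount xs → free ∈ xs
freeCount-pos⇒free∈ (x ∷ xs) pos with x ℤ.≟ free
... | yes refl = here refl
... | no _     = there (freeCount-pos⇒free∈ xs pos)

Labelled : List ℤ → Set
Labelled = All (free ℤ.≤_)

Ok⇒Labelled : ∀ {d t} → Ok d t → Labelled (leaves t)
Oks⇒Labelled : ∀ {d ts} → All (Ok d) ts → Labelled (leavesL ts)
Ok⇒Labelled (okLeaf free≤z _) = free≤z ∷ []
Ok⇒Labelled (okNode _ oks _ _) = Oks⇒Labelled oks
Oks⇒Labelled [] = []
Oks⇒Labelled (ok ∷ oks) = Allₚ.++⁺ (Ok⇒Labelled ok) (Oks⇒Labelled oks)

labelled-≤free⇒free∈ : ∀ {xs} → Labelled xs → Any (ℤ._≤ free) xs → free ∈ xs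
labelled-≤free⇒free∈ (free≤x ∷ _) (here x≤free) = here (ℤₚ.≤-antisym free≤x x≤free)
labelled-≤free⇒free∈ (_ ∷ lab) (there any) = there (labelled-≤free⇒free∈ lab any)

Guarded : ℕ → List ℤ → Set
Guarded d zs = ∀ xs ys → zs ≡ xs ++ + d ∷ ys → All (+ d ℤ.≤_) xs

module _ {d : ℕ} where

  guarded-[] : Guarded d []
  guarded-[] [] _ ()
  guarded-[] (_ ∷ _) _ ()

  guarded-∷ : ∀ {z zs} → (+ d ∈ zs → + d ℤ.≤ z) → Guarded d zs → Guarded d (z ∷ zs)
  guarded-∷ d≤z g [] _ _ = []
  guarded-∷ d≤z g (x ∷ xs) ys refl = d≤z (∈-++⁺ʳ xs (here refl)) ∷ g xs ys refl

  guarded-head : ∀ {z zs} → Guarded d (z ∷ zs) → + d ∈ zs → + d ℤ.≤ z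
  guarded-head g d∈zs with ∈-∃++ d∈zs
  ... | xs , ys , refl = All.head (g (_ ∷ xs) ys refl)

  guarded-tail : ∀ {z zs} → Guarded d (z ∷ zs) → Guarded d zs
  guarded-tail g xs ys refl = All.tail (g (_ ∷ xs) ys refl)

  guarded-++ˡ : ∀ xs {ys} → Guarded d (xs ++ ys) → Guarded d xs
  guarded-++ˡ [] g = guarded-[]
  guarded-++ˡ (x ∷ xs) g =
    guarded-∷ (guarded-head g ∘ ∈-++⁺ˡ) (guarded-++ˡ xs (guarded-tail g))

  guarded-++ʳ : ∀ xs {ys} → Guarded d (xs ++ ys) → Guarded d ys
  guarded-++ʳ [] g = g
  guarded-++ʳ (x ∷ xs) g = guarded-++ʳ xs (guarded-tail g)

guarded-free∈⇒0∉ : ∀ xs {ys} → Guarded 0 (xs ++ ys) → free ∈ xs → + 0 ∉ ys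
guarded-free∈⇒0∉ (x ∷ xs) g (here refl) 0∈ys with guarded-head g (∈-++⁺ʳ xs 0∈ys)
... | ()
guarded-free∈⇒0∉ (x ∷ xs) g (there free∈xs) = guarded-free∈⇒0∉ xs (guarded-tail g) free∈xs

-- Shift n t t' m  iff  shiftT n t ≡ (m , t') for a tree t with all labels ≥ -1:
-- n free leaves remain to be shifted on entering t, m on leaving it.
data LabelShift : ℕ → ℤ → ℤ → ℕ → Set where
  nonfree : ∀ {n} k → LabelShift n (+ k) (+ suc k) n
  shifted : ∀ {n} → LabelShift (suc n) free (+ 0) n
  kept    : LabelShift 0 free free 0

data LabelsShift : ℕ → List ℤ → List ℤ → ℕ → Set where
  []  : ∀ {n} → LabelsShift n [] [] n
  _∷_ : ∀ {n m k x y xs ys} → LabelShift n x y m → LabelsShift m xs ys k →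
        LabelsShift n (x ∷ xs) (y ∷ ys) k

data Shift : ℕ → Tree → Tree → ℕ → Set
data Shifts : ℕ → List Tree → List Tree → ℕ → Set

data Shift where
  leaf : ∀ {n z y m} → LabelShift n z y m → Shift n (leaf z) (leaf y) m
  node : ∀ {n ts ts′ m} → Shifts n ts ts′ m → Shift n (node ts) (node ts′) m

data Shifts where
  []  : ∀ {n} → Shifts n [] [] n
  _∷_ : ∀ {n m k t t′ ts ts′} → Shift n t t′ m → Shifts m ts ts′ k → Shifts n (t ∷ ts) (t′ ∷ ts′) k

_++ˢ_ : ∀ {n m k xs ys xs′ ys′} →
  LabelsShift n xs ys m → LabelsShift m xs′ ys′ k → LabelsShift n (xs ++ xs′) (ys ++ ys′) k
[] ++ˢ s = s
(l ∷ r) ++ˢ s = l ∷ (r ++ˢ s)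

shift-leaves : ∀ {n t t′ m} → Shift n t t′ m → LabelsShift n (leaves t) (leaves t′) m
shifts-leaves : ∀ {n ts ts′ m} → Shifts n ts ts′ m → LabelsShift n (leavesL ts) (leavesL ts′) m
shift-leaves (leaf l) = l ∷ []
shift-leaves (node r) = shifts-leaves r
shifts-leaves [] = []
shifts-leaves (s ∷ r) = shift-leaves s ++ˢ shifts-leaves r

shiftT-sound : ∀ n t → Labelled (leaves t) → Shift n t (proj₂ (shiftT n t)) (proj₁ (shiftT n t))
shiftL-sound : ∀ n ts → Labelled (leavesL ts) → Shifts n ts (proj₂ (shiftL n ts)) (proj₁ (shiftL n ts))
shiftT-sound n (leaf (+ k)) _ =
  subst (λ y → Shift n (leaf (+ k)) (leaf (+ y)) n) (ℕₚ.+-comm 1 k) (leaf (nonfree k))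
shiftT-sound zero (leaf -[1+ zero ]) _ = leaf kept
shiftT-sound (suc n) (leaf -[1+ zero ]) _ = leaf shifted
shiftT-sound n (leaf -[1+ suc _ ]) (ℤ.-≤- () ∷ _)
shiftT-sound n (node ts) lab with shiftL n ts | shiftL-sound n ts lab
... | _ , _ | r = node r
shiftL-sound n [] _ = []
shiftL-sound n (t ∷ ts) lab with shiftT n t | shiftT-sound n t (Allₚ.++⁻ˡ (leaves t) lab)
... | m , _ | s with shiftL m ts | shiftL-sound m ts (Allₚ.++⁻ʳ (leaves t) lab)
... | _ , _ | r = s ∷ r

shiftT-complete : ∀ {n t t′ m} → Shift n t t′ m → shiftT n t ≡ (m , t′)
shiftL-complete : ∀ {n ts ts′ m} → Shifts n ts ts′ m → shiftL n ts ≡ (m , ts′)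
shiftT-complete {n} (leaf (nonfree k)) = cong (λ y → n , leaf (+ y)) (ℕₚ.+-comm k 1)
shiftT-complete (leaf shifted) = refl
shiftT-complete (leaf kept) = refl
shiftT-complete (node r) rewrite shiftL-complete r = refl
shiftL-complete [] = refl
shiftL-complete (s ∷ r) rewrite shiftT-complete s | shiftL-complete r = refl

decr-shift : ∀ {n t t′ m} → Shift n t t′ m → decr t′ ≡ t
decrL-shifts : ∀ {n ts ts′ m} → Shifts n ts ts′ m → decrL ts′ ≡ ts
decr-shift (leaf (nonfree k)) = refl
decr-shift (leaf shifted) = refl
decr-shift (leaf kept) = refl
decr-shift (node r) = cong node (decrL-shifts r)
decrL-shifts [] = refl
decrL-shifts (s ∷ r) = cong₂ _∷_ (decr-shift s) (decrL-shifts r)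

shift-source-labelled : ∀ {n xs ys m} → LabelsShift n xs ys m → Labelled xs
shift-source-labelled [] = []
shift-source-labelled (nonfree k ∷ r) = ℤ.-≤+ ∷ shift-source-labelled r
shift-source-labelled (shifted ∷ r) = ℤₚ.≤-refl ∷ shift-source-labelled r
shift-source-labelled (kept ∷ r) = ℤₚ.≤-refl ∷ shift-source-labelled r

freeCount-shift : ∀ {n xs ys m} → LabelsShift n xs ys m → freeCount ys + n ≡ freeCount xs + m
freeCount-shift [] = refl
freeCount-shift (nonfree k ∷ r) = freeCount-shift r
freeCount-shift {suc n} (_∷_ {ys = ys} shifted r) =
  trans (ℕₚ.+-suc (freeCount ys) n) (cong suc (freeCount-shift r))
freeCount-shift (kept ∷ r) = cong suc (freeCount-shift r)

budget-shift : ∀ {n xs ys m} → LabelsShift n xs ys m → m ≡ n ∸ freeCount xs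
budget-shift [] = refl
budget-shift (nonfree k ∷ r) = budget-shift r
budget-shift (shifted ∷ r) = budget-shift r
budget-shift (_∷_ {xs = xs} kept r) = trans (budget-shift r) (ℕₚ.0∸n≡0 (freeCount xs))

fl-shiftT : ∀ T {i} → Labelled (leaves T) → i ≤ fl T → fl (proj₂ (shiftT (fl T ∸ i) T)) ≡ i
fl-shiftT T {i} lab i≤flT = ℕₚ.+-cancelʳ-≡ (fl T ∸ i) _ i (begin
    fl T′ + (fl T ∸ i)  ≡⟨ freeCount-shift r ⟩
    fl T + m            ≡⟨ cong (λ k → fl T + k) exhausted ⟩
    fl T + 0            ≡⟨ ℕₚ.+-identityʳ (fl T) ⟩
    fl T                ≡⟨ ℕₚ.m+[n∸m]≡n i≤flT ⟨
    i + (fl T ∸ i)      ∎)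
  where
    open ≡-Reasoning
    m = proj₁ (shiftT (fl T ∸ i) T)
    T′ = proj₂ (shiftT (fl T ∸ i) T)
    r = shift-leaves (shiftT-sound (fl T ∸ i) T lab)
    exhausted : m ≡ 0
    exhausted = trans (budget-shift r) (ℕₚ.m≤n⇒m∸n≡0 (ℕₚ.m∸n≤m (fl T) i))

budget-unchanged : ∀ {n xs ys m} → LabelsShift n xs ys m → + 0 ∉ ys → n ≡ m
budget-unchanged [] _ = refl
budget-unchanged (nonfree k ∷ r) 0∉ = budget-unchanged r (0∉ ∘ there)
budget-unchanged (shifted ∷ r) 0∉ with 0∉ (here refl)
... | ()
budget-unchanged (kept ∷ r) 0∉ = budget-unchanged r (0∉ ∘ there)

exhausted-0∉ : ∀ {xs ys m} → LabelsShift 0 xs ys m → + 0 ∉ ys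
exhausted-0∉ (nonfree k ∷ r) (there 0∈) = exhausted-0∉ r 0∈
exhausted-0∉ (kept ∷ r) (there 0∈) = exhausted-0∉ r 0∈

label-shift-Ok : ∀ {p n z y m} → Ok (suc p) (leaf z) → LabelShift n z y m → Ok (suc (suc p)) (leaf y)
label-shift-Ok (okLeaf _ (ℤ.+<+ k<p)) (nonfree k) = okLeaf ℤ.-≤+ (ℤ.+<+ (s≤s k<p))
label-shift-Ok _ shifted = okLeaf ℤ.-≤+ (ℤ.+<+ (s≤s z≤n))
label-shift-Ok _ kept = okLeaf (ℤ.-≤- z≤n) ℤ.-<+

label-shift-bound : ∀ d {n x y m} → LabelShift n x y m →
  x ℤ.≤ + d ℤ.- + 2 → y ℤ.≤ + suc d ℤ.- + 2
label-shift-bound (suc (suc d)) (nonfree k) (ℤ.+≤+ k≤d) = ℤ.+≤+ (s≤s k≤d)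
label-shift-bound zero shifted (ℤ.-≤- ())
label-shift-bound (suc zero) shifted _ = ℤₚ.≤-refl
label-shift-bound (suc (suc d)) shifted _ = ℤ.+≤+ z≤n
label-shift-bound zero kept _ = ℤₚ.≤-refl
label-shift-bound (suc d) kept _ = ℤ.-≤+

any-shift-bound : ∀ d {n xs ys m} → LabelsShift n xs ys m →
  Any (ℤ._≤ + d ℤ.- + 2) xs → Any (ℤ._≤ + suc d ℤ.- + 2) ys
any-shift-bound d (l ∷ _) (here x≤) = here (label-shift-bound d l x≤)
any-shift-bound d (_ ∷ r) (there any) = there (any-shift-bound d r any)

label-shift-mono : ∀ {d n x y m} → LabelShift n x y m → + d ℤ.≤ x → + suc d ℤ.≤ y
label-shift-mono (nonfree k) (ℤ.+≤+ d≤k) = ℤ.+≤+ (s≤s d≤k)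

shift-reflects-∈ : ∀ {d n xs ys m} → LabelsShift n xs ys m → + suc d ∈ ys → + d ∈ xs
shift-reflects-∈ (nonfree k ∷ _) (here refl) = here refl
shift-reflects-∈ (_ ∷ r) (there d∈) = there (shift-reflects-∈ r d∈)

guarded-shift : ∀ {d n xs ys m} → LabelsShift n xs ys m → Guarded d xs → Guarded (suc d) ys
guarded-shift [] _ = guarded-[]
guarded-shift (l ∷ r) g =
  guarded-∷ (label-shift-mono l ∘ guarded-head g ∘ shift-reflects-∈ r) (guarded-shift r (guarded-tail g))

guarded-root : ∀ {n xs ys m} → LabelsShift n xs ys m → Guarded 0 ys
guarded-root [] = guarded-[]
guarded-root (nonfree k ∷ r) = guarded-∷ (λ _ → ℤ.+≤+ z≤n) (guarded-root r)
guarded-root (shifted ∷ r) = guarded-∷ (λ _ → ℤₚ.≤-refl) (guarded-root r)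
guarded-root (kept ∷ r) = guarded-∷ (λ 0∈ → ⊥-elim (exhausted-0∉ r 0∈)) (guarded-root r)

shifts-nonempty : ∀ {n ts ts′ m} → Shifts n ts ts′ m → ts ≢ [] → ts′ ≢ []
shifts-nonempty [] nonempty = nonempty
shifts-nonempty (_ ∷ _) _ = λ ()

guarded-shifts : ∀ {d n ts ts′ m} → All (Guarded d ∘ leaves) ts → Shifts n ts ts′ m →
  All (Guarded (suc d) ∘ leaves) ts′
guarded-shifts [] [] = []
guarded-shifts (g ∷ gs) (s ∷ r) = guarded-shift (shift-leaves s) g ∷ guarded-shifts gs r

shift-Ok-node : ∀ {d n ts t′ m} → Ok d (node ts) → Shift n (node ts) t′ m →
  (0 < suc d → Any (ℤ._≤ + suc d ℤ.- + 2) (leaves t′)) → Ok (suc d) t′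
shift-Ok : ∀ {d n t t′ m} → Ok (suc d) t → Shift n t t′ m → Ok (suc (suc d)) t′
shift-Oks : ∀ {d n ts ts′ m} → All (Ok (suc d)) ts → Shifts n ts ts′ m → All (Ok (suc (suc d))) ts′
shift-Ok-node (okNode nonempty oks _ gs) (node r) cond2 =
  okNode (shifts-nonempty r nonempty) (shift-Oks oks r) cond2 (guarded-shifts gs r)
shift-Ok ok@(okLeaf _ _) (leaf l) = label-shift-Ok ok l
shift-Ok {d} ok@(okNode _ _ cond2 _) s@(node r) =
  shift-Ok-node ok s (λ _ → any-shift-bound (suc d) (shifts-leaves r) (cond2 (s≤s z≤n)))
shift-Oks [] [] = []
shift-Oks (ok ∷ oks) (s ∷ r) = shift-Ok ok s ∷ shift-Oks oks r

shift-from-decr : ∀ t m → Labelled (leaves t) → Guarded 0 (leaves t) → (free ∈ leaves t → m ≡ 0) →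
  ∃ λ n → Shift n (decr t) t m
shifts-from-decrL : ∀ ts m → Labelled (leavesL ts) → Guarded 0 (leavesL ts) → (free ∈ leavesL ts → m ≡ 0) →
  ∃ λ n → Shifts n (decrL ts) ts m
shift-from-decr (leaf (+ zero)) m _ _ _ = suc m , leaf shifted
shift-from-decr (leaf (+ suc k)) m _ _ _ = m , leaf (nonfree k)
shift-from-decr (leaf -[1+ zero ]) m _ _ exhausted with exhausted (here refl)
... | refl = 0 , leaf kept
shift-from-decr (leaf -[1+ suc _ ]) m (ℤ.-≤- () ∷ _) _ _
shift-from-decr (node ts) m lab g exhausted =
  let n , r = shifts-from-decrL ts m lab g exhausted in n , node r
shifts-from-decrL [] m _ _ _ = m , []
shifts-from-decrL (t ∷ ts) m lab g exhausted =
  let n₁ , r = shifts-from-decrL ts m (Allₚ.++⁻ʳ (leaves t) lab) (guarded-++ʳ (leaves t) g)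
                 (exhausted ∘ ∈-++⁺ʳ (leaves t))
      n , s = shift-from-decr t n₁ (Allₚ.++⁻ˡ (leaves t) lab) (guarded-++ˡ (leaves t) g) λ free∈t →
                trans (budget-unchanged (shifts-leaves r) (guarded-free∈⇒0∉ (leaves t) g free∈t))
                      (exhausted (∈-++⁺ˡ free∈t))
  in n , s ∷ r

⊕-decorated : (T₁ T₂ : Tree) → Decorated T₁ → Decorated T₂ →
  (i : ℕ) → 1 ≤ i → i ≤ fl T₁ →
  Decorated (⊕ T₁ i T₂) × hd (⊕ T₁ i T₂) ≡ T₁ × tl (⊕ T₁ i T₂) ≡ T₂ × fl (⊕ T₁ i T₂) ≡ i + fl T₂
⊕-decorated (node ts₁) (node ts₂) (_ , ok₁) (_ , okNode _ oks₂ _ guarded₂) i 1≤i i≤fl =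
  (tt , okNode (λ ()) (ok-c ∷ oks₂) (λ ()) (guarded-root (shift-leaves s) ∷ guarded₂)) ,
  decr-shift s , refl , trans (freeCount-++ (leaves c) (leavesL ts₂)) (cong (_+ fl (node ts₂)) fl-c)
  where
    T₁ = node ts₁
    lab = Ok⇒Labelled ok₁
    c = proj₂ (shiftT (fl T₁ ∸ i) T₁)
    s = shiftT-sound (fl T₁ ∸ i) T₁ lab
    fl-c : fl c ≡ i
    fl-c = fl-shiftT T₁ lab i≤fl
    free∈c : free ∈ leaves c
    free∈c = freeCount-pos⇒free∈ (leaves c) (subst (1 ≤_) (sym fl-c) 1≤i)
    ok-c : Ok 1 c
    ok-c = shift-Ok-node ok₁ s (λ _ → Any.map (λ { refl → ℤₚ.≤-refl }) free∈c)

leftmostChild : Tree → Tree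
leftmostChild (node (c ∷ _)) = c
leftmostChild t = t

⊕-unique : (T₁ T₂ T′ : Tree) → Decorated T′ → LeftInternal2 T′ → hd T′ ≡ T₁ → tl T′ ≡ T₂ →
  ∃! _≡_ (λ (j : ℕ) → 1 ≤ j × j ≤ fl T₁ × T′ ≡ ⊕ T₁ j T₂)
⊕-unique _ _ _ (_ , okNode _ (ok-c@(okNode _ _ cond2 _) ∷ _) _ (guarded-c ∷ _))
    (c@(node _) , c₂ , cs , refl , _) refl refl =
  fl c , (free∈⇒freeCount-pos free∈c , fl-c≤ , T′≡⊕) , unique
  where
    T₁ = decr c
    lab = Ok⇒Labelled ok-c
    free∈c : free ∈ leaves c
    free∈c = labelled-≤free⇒free∈ lab (cond2 (s≤s z≤n))
    shift-c = shift-from-decr c 0 lab guarded-c (λ _ → refl)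
    n = proj₁ shift-c
    s = proj₂ shift-c
    count : fl c + n ≡ fl T₁
    count = trans (freeCount-shift (shift-leaves s)) (ℕₚ.+-identityʳ (fl T₁))
    fl-c≤ : fl c ≤ fl T₁
    fl-c≤ = subst (fl c ≤_) count (ℕₚ.m≤m+n (fl c) n)
    budget : fl T₁ ∸ fl c ≡ n
    budget = trans (cong (_∸ fl c) (sym count)) (ℕₚ.m+n∸m≡n (fl c) n)
    T′≡⊕ : node (c ∷ c₂ ∷ cs) ≡ ⊕ T₁ (fl c) (node (c₂ ∷ cs))
    T′≡⊕ = cong (λ c′ → node (c′ ∷ c₂ ∷ cs))
      (sym (cong proj₂ (trans (cong (λ k → shiftT k T₁) budget) (shiftT-complete s))))
    unique : ∀ {j} → 1 ≤ j × j ≤ fl T₁ × node (c ∷ c₂ ∷ cs) ≡ ⊕ T₁ j (node (c₂ ∷ cs)) → fl c ≡ j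
    unique (_ , j≤ , T′≡⊕j) =
      trans (cong (fl ∘ leftmostChild) T′≡⊕j) (fl-shiftT T₁ (shift-source-labelled (shift-leaves s)) j≤)

proposition2p7 : (T₁ T₂ : Tree) → Decorated T₁ → Decorated T₂ →
    ((i : ℕ) → 1 ≤ i → i ≤ fl T₁ →
      Decorated (⊕ T₁ i T₂) × hd (⊕ T₁ i T₂) ≡ T₁ × tl (⊕ T₁ i T₂) ≡ T₂
        × fl (⊕ T₁ i T₂) ≡ i + fl T₂)
    × ((T' : Tree) → Decorated T' → LeftInternal2 T' → hd T' ≡ T₁ → tl T' ≡ T₂ →
      ∃! _≡_ (λ (j : ℕ) → 1 ≤ j × j ≤ fl T₁ × T' ≡ ⊕ T₁ j T₂))
proposition2p7 T₁ T₂ d₁ d₂ = ⊕-decorated T₁ T₂ d₁ d₂ , ⊕-unique T₁ T₂
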